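{- Let $A=A_1\sqcup A_2\sqcup\cdots\sqcup A_t$ be a dyadic partition of a finite set $A$. Then for every $I\subseteq[t]$, \[ |A|-\sum_{i\in I}|A_i|\ \ge\ \left\lfloor\frac{|A|}{2^{|I|}}\right\rfloor. \]
   Context: A dyadic partition of a finite set $A$ is a partition $A=A_1\sqcup A_2\sqcup\cdots\sqcup A_t$ into parts such that $|A_i|\le\frac12(|A_i|+\cdots+|A_t|)$ for all $i<t$ and $|A_t|=1$. -}

module Defs where

open import Data.Nat using (ℕ; zero; suc; _+_; _*_; _≤_; _<_; _≤?_; _^_)
open import Data.Nat.Properties using (m^n≢0)
open import Data.Nat.DivMod using (_/_)
open import Data.Nat.ListAction using (sum)
open import Data.Fin using (Fin; toℕ; fromℕ; _≟_)
open import Data.Fin.Subset using (Subset)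
open import Data.Fin.Subset.Properties using (_∈?_)
open import Data.List using (List; length; filter; map; allFin)
open import Relation.Binary.PropositionalEquality using (_≡_)


-- A finite set A of size n is modelled as Fin n.  A partition of A into
-- t parts A_1,...,A_t is given by a labelling  c : Fin n → Fin t,
-- with A_i = { x | c x ≡ i }  (parts indexed 0,...,t-1).

partSize : ∀ {n t} → (Fin n → Fin t) → Fin t → ℕ
partSize {n} c i = length (filter (λ x → c x ≟ i) (allFin n))

tailSum : ∀ {n t} → (Fin n → Fin t) → Fin t → ℕ
tailSum {n} {t} c i = sum (map (partSize c) (filter (λ j → toℕ i ≤? toℕ j) (allFin t)))

sumOver : ∀ {n t} → (Fin n → Fin t) → Subset t → ℕ
sumOver {n} {t} c I = sum (map (partSize c) (filter (λ j → j ∈? I) (allFin t)))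

-- A dyadic partition into t = suc k parts (t ≥ 1 is forced by |A_t| = 1).
record IsDyadicPartition {n k : ℕ} (c : Fin n → Fin (suc k)) : Set where
  field
    nonempty : ∀ i → 1 ≤ partSize c i
    dyadic   : ∀ i → suc (toℕ i) < suc k → 2 * partSize c i ≤ tailSum c i
    lastOne  : partSize c (fromℕ k) ≡ 1

floorDivPow2 : ℕ → ℕ → ℕ
floorDivPow2 m e = _/_ m (2 ^ e) {{m^n≢0 2 e}}

{-# OPTIONS --safe #-}
-- Write a i = |A_i|.  Relaxed to 2 a i ≤ 1 + Σ_{j≥i} a j (which the last part, of size 1,
-- also satisfies), the dyadic condition says a 0 ≤ 1 + R, where R is the total size of the
-- later parts.  Induct on the number of parts, peeling off A_0.  If 0 ∉ I, then
-- ⌊(a 0 + R)/2^e⌋ ≤ a 0 + ⌊R/2^e⌋.  If 0 ∈ I, the extra halving absorbs a 0, because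
-- ⌊(a 0 + R)/2⌋ ≤ R.
module Submission where

open import Defs
open import Data.Nat using (ℕ; suc; _+_; _≤_)
open import Data.Fin using (Fin)
open import Data.Fin.Subset using (Subset; ∣_∣)

open import Level using (Level)
open import Data.Bool using (true; false; if_then_else_)
open import Data.Nat using (zero; _*_; _^_; _/_; _<_; z≤n; s≤s; s≤s⁻¹; NonZero)
open import Data.Nat.Properties
  using (_≤?_; ≤-trans; m≤m+n; m≤m*n; m≤n⇒m≤1+n; n<1+n; +-monoˡ-≤; +-monoʳ-≤; +-cancelˡ-≤;
         +-assoc; +-suc; +-identityʳ; *-comm; m^n≢0; module ≤-Reasoning;
         +-0-commutativeMonoid; +-commutativeSemigroup)
open import Data.Nat.DivMod
  using (/-monoˡ-≤; +-distrib-/-∣ˡ; m*n/n≡m; m<n*o⇒m/o<n; m/n/o≡m/[n*o])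
open import Data.Nat.Divisibility using (n∣m*n)
import Data.Nat.ListAction as ListAction
open import Data.Fin using (zero; suc; toℕ; fromℕ; _≟_)
open import Data.Fin.Properties using (≤fromℕ; ≤∧≢⇒<; toℕ-fromℕ)
open import Data.Fin.Subset using (inside; outside)
open import Data.Fin.Subset.Properties using (_∈?_)
open import Data.List using (map; filter; length; tabulate)
open import Data.Vec using (_∷_; [])
open import Function using (_∘_; id; mk⇔)
open import Relation.Nullary using (does; yes; no)
open import Relation.Nullary.Decidable using (does-⇔)
open import Relation.Unary using (Pred; Decidable)
open import Relation.Binary.PropositionalEquality
open import Algebra.Properties.CommutativeMonoid.Sum +-0-commutativeMonoid
  using (sum; sum-syntax; sum-cong-≗; sum-replicate-zero; ∑-comm)
open import Algebra.Properties.CommutativeSemigroup +-commutativeSemigroup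
  using (x∙yz≈y∙xz)

open IsDyadicPartition using (nonempty; dyadic; lastOne)

private
  variable
    p : Level
    A : Set p
    t : ℕ

[m+n]/o≤m+n/o : ∀ m n o .{{_ : NonZero o}} → (m + n) / o ≤ m + n / o
[m+n]/o≤m+n/o m n o = begin
  (m + n) / o       ≤⟨ /-monoˡ-≤ o (+-monoˡ-≤ n (m≤m*n m o)) ⟩
  (m * o + n) / o   ≡⟨ +-distrib-/-∣ˡ n (n∣m*n m) ⟩
  m * o / o + n / o ≡⟨ cong (_+ n / o) (m*n/n≡m m o) ⟩
  m + n / o         ∎
  where open ≤-Reasoning

m≤1+n⇒[m+n]/2≤n : ∀ {m n} → m ≤ suc n → (m + n) / 2 ≤ n
m≤1+n⇒[m+n]/2≤n {m} {n} m≤1+n = s≤s⁻¹ (m<n*o⇒m/o<n (begin-strict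
  m + n             ≤⟨ +-monoˡ-≤ n m≤1+n ⟩
  suc (n + n)       <⟨ n<1+n _ ⟩
  suc (suc (n + n)) ≡⟨ cong (2 +_) n+n≡n*2 ⟩
  suc n * 2         ∎))
  where
  open ≤-Reasoning
  n+n≡n*2 : n + n ≡ n * 2
  n+n≡n*2 = trans (cong (n +_) (sym (+-identityʳ n))) (*-comm 2 n)

2*m≤1+m+n⇒m≤1+n : ∀ {m n} → 2 * m ≤ suc (m + n) → m ≤ suc n
2*m≤1+m+n⇒m≤1+n {m} {n} 2m≤ = +-cancelˡ-≤ m m (suc n) (begin
  m + m       ≡⟨ cong (m +_) (+-identityʳ m) ⟨
  2 * m       ≤⟨ 2m≤ ⟩
  suc (m + n) ≡⟨ +-suc m n ⟨
  m + suc n   ∎)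
  where open ≤-Reasoning

sumWhere : {P : Pred (Fin t) p} → Decidable P → (Fin t → ℕ) → ℕ
sumWhere {t} P? a = ∑[ i < t ] (if does (P? i) then a i else 0)

sumFrom : (Fin t → ℕ) → Fin t → ℕ
sumFrom a i = sumWhere (λ j → toℕ i ≤? toℕ j) a

sum-map-filter-tabulate : {P : Pred A p} (P? : Decidable P) (a : A → ℕ) (f : Fin t → A) →
  ListAction.sum (map a (filter P? (tabulate f))) ≡ sumWhere (P? ∘ f) (a ∘ f)
sum-map-filter-tabulate {t = zero}  P? a f = refl
sum-map-filter-tabulate {t = suc t} P? a f with does (P? (f zero))
... | true  = cong (a (f zero) +_) (sum-map-filter-tabulate P? a (f ∘ suc))
... | false = sum-map-filter-tabulate P? a (f ∘ suc)

length-filter-tabulate : {P : Pred A p} (P? : Decidable P) (f : Fin t → A) →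
  length (filter P? (tabulate f)) ≡ sumWhere (P? ∘ f) (λ _ → 1)
length-filter-tabulate {t = zero}  P? f = refl
length-filter-tabulate {t = suc t} P? f with does (P? (f zero))
... | true  = cong suc (length-filter-tabulate P? (f ∘ suc))
... | false = length-filter-tabulate P? (f ∘ suc)

sumWhere-≟≡1 : (j : Fin t) → sumWhere (j ≟_) (λ _ → 1) ≡ 1
sumWhere-≟≡1 {suc t} zero = cong (1 +_) (sum-replicate-zero t)
sumWhere-≟≡1 (suc j)      = sumWhere-≟≡1 j

∑-ones : ∀ n → ∑[ i < n ] 1 ≡ n
∑-ones zero    = refl
∑-ones (suc n) = cong suc (∑-ones n)

∑-partSize : ∀ {n} (c : Fin n → Fin t) → ∑[ i < t ] partSize c i ≡ n
∑-partSize {t} {n} c = begin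
  ∑[ i < t ] partSize c i
    ≡⟨ sum-cong-≗ (λ i → length-filter-tabulate (λ x → c x ≟ i) id) ⟩
  ∑[ i < t ] sumWhere (λ x → c x ≟ i) (λ _ → 1)
    ≡⟨ ∑-comm (λ i x → if does (c x ≟ i) then 1 else 0) ⟩
  ∑[ x < n ] sumWhere (c x ≟_) (λ _ → 1)
    ≡⟨ sum-cong-≗ (sumWhere-≟≡1 ∘ c) ⟩
  ∑[ x < n ] 1
    ≡⟨ ∑-ones n ⟩
  n ∎
  where open ≡-Reasoning

sumFrom-suc : (a : Fin (suc t) → ℕ) (i : Fin t) → sumFrom a (suc i) ≡ sumFrom (a ∘ suc) i
sumFrom-suc a i = sum-cong-≗ λ j →
  cong (λ b → if b then a (suc j) else 0)
       (does-⇔ (mk⇔ s≤s⁻¹ s≤s) (suc (toℕ i) ≤? suc (toℕ j)) (toℕ i ≤? toℕ j))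

≤-sumFrom : (a : Fin t → ℕ) (i : Fin t) → a i ≤ sumFrom a i
≤-sumFrom a zero    = m≤m+n (a zero) _
≤-sumFrom a (suc i) = subst (a (suc i) ≤_) (sym (sumFrom-suc a i)) (≤-sumFrom (a ∘ suc) i)

WeaklyDyadic : (Fin t → ℕ) → Set
WeaklyDyadic a = ∀ i → 2 * a i ≤ suc (sumFrom a i)

weaklyDyadic-head : {a : Fin (suc t) → ℕ} → WeaklyDyadic a → a zero ≤ suc (sum (a ∘ suc))
weaklyDyadic-head wd = 2*m≤1+m+n⇒m≤1+n (wd zero)

weaklyDyadic-tail : {a : Fin (suc t) → ℕ} → WeaklyDyadic a → WeaklyDyadic (a ∘ suc)
weaklyDyadic-tail {a = a} wd i = subst (λ m → 2 * a (suc i) ≤ suc m) (sumFrom-suc a i) (wd (suc i))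

⌊∑/2^∣I∣⌋+∑[I]≤∑ : (a : Fin t → ℕ) → WeaklyDyadic a → (I : Subset t) →
  floorDivPow2 (sum a) ∣ I ∣ + sumWhere (_∈? I) a ≤ sum a
⌊∑/2^∣I∣⌋+∑[I]≤∑ a wd [] = z≤n
⌊∑/2^∣I∣⌋+∑[I]≤∑ a wd (b ∷ I) = begin
  floorDivPow2 (x + R) ∣ b ∷ I ∣ + sumWhere (_∈? b ∷ I) a ≤⟨ peel b ⟩
  x + (R / 2 ^ e + s)                                    ≤⟨ +-monoʳ-≤ x ih ⟩
  x + R                                                  ∎
  where
  open ≤-Reasoning
  x = a zero
  R = sum (a ∘ suc)
  s = sumWhere (_∈? I) (a ∘ suc)
  e = ∣ I ∣
  instance
    2^e≢0 : NonZero (2 ^ e)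
    2^e≢0 = m^n≢0 2 e
    2^1+e≢0 : NonZero (2 ^ suc e)
    2^1+e≢0 = m^n≢0 2 (suc e)

  ih : R / 2 ^ e + s ≤ R
  ih = ⌊∑/2^∣I∣⌋+∑[I]≤∑ (a ∘ suc) (weaklyDyadic-tail {a = a} wd) I

  peel : ∀ b → floorDivPow2 (x + R) ∣ b ∷ I ∣ + sumWhere (_∈? b ∷ I) a ≤ x + (R / 2 ^ e + s)
  peel outside = begin
    (x + R) / 2 ^ e + s ≤⟨ +-monoˡ-≤ s ([m+n]/o≤m+n/o x R (2 ^ e)) ⟩
    x + R / 2 ^ e + s   ≡⟨ +-assoc x _ s ⟩
    x + (R / 2 ^ e + s) ∎
  peel inside = begin
    (x + R) / (2 * 2 ^ e) + (x + s) ≡⟨ cong (_+ (x + s)) (m/n/o≡m/[n*o] (x + R) 2 (2 ^ e)) ⟨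
    (x + R) / 2 / 2 ^ e + (x + s)   ≤⟨ +-monoˡ-≤ (x + s) (/-monoˡ-≤ (2 ^ e) [x+R]/2≤R) ⟩
    R / 2 ^ e + (x + s)             ≡⟨ x∙yz≈y∙xz (R / 2 ^ e) x s ⟩
    x + (R / 2 ^ e + s)             ∎
    where
    [x+R]/2≤R : (x + R) / 2 ≤ R
    [x+R]/2≤R = m≤1+n⇒[m+n]/2≤n (weaklyDyadic-head {a = a} wd)

sumOver≡sumWhere : ∀ {n} (c : Fin n → Fin t) (I : Subset t) →
                   sumOver c I ≡ sumWhere (_∈? I) (partSize c)
sumOver≡sumWhere c I = sum-map-filter-tabulate (_∈? I) (partSize c) id

tailSum≡sumFrom : ∀ {n} (c : Fin n → Fin t) (i : Fin t) → tailSum c i ≡ sumFrom (partSize c) i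
tailSum≡sumFrom c i = sum-map-filter-tabulate (λ j → toℕ i ≤? toℕ j) (partSize c) id

dyadic⇒weaklyDyadic : ∀ {n k} {c : Fin n → Fin (suc k)} →
                      IsDyadicPartition c → WeaklyDyadic (partSize c)
dyadic⇒weaklyDyadic {k = k} {c} dp i with i ≟ fromℕ k
... | yes refl = subst (λ m → 2 * m ≤ suc (sumFrom (partSize c) i)) (sym (lastOne dp))
                   (s≤s (≤-trans (nonempty dp i) (≤-sumFrom (partSize c) i)))
... | no i≢k   = m≤n⇒m≤1+n
                   (subst (2 * partSize c i ≤_) (tailSum≡sumFrom c i) (dyadic dp i (s≤s i<k)))
  where
  i<k : toℕ i < k
  i<k = subst (toℕ i <_) (toℕ-fromℕ k) (≤∧≢⇒< (≤fromℕ i) i≢k)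

lemma3p5 : ∀ (n k : ℕ) (c : Fin n → Fin (suc k)) → IsDyadicPartition c →
             (I : Subset (suc k)) → floorDivPow2 n ∣ I ∣ + sumOver c I ≤ n
lemma3p5 n k c dp I = begin
  floorDivPow2 n ∣ I ∣ + sumOver c I
    ≡⟨ cong₂ (λ m s → floorDivPow2 m ∣ I ∣ + s) (sym (∑-partSize c)) (sumOver≡sumWhere c I) ⟩
  floorDivPow2 (sum a) ∣ I ∣ + sumWhere (_∈? I) a
    ≤⟨ ⌊∑/2^∣I∣⌋+∑[I]≤∑ a (dyadic⇒weaklyDyadic dp) I ⟩
  sum a
    ≡⟨ ∑-partSize c ⟩
  n ∎
  where
  open ≤-Reasoning
  a = partSize c
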